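{- For every $\pi\in\mathfrak{S}_n^k$, ${\rm inv}(\pi)=\widetilde{{\rm inv}}(\pi)$ and ${\rm maj}(\pi)=\widetilde{{\rm maj}}(\pi)$.
   Context: A partial permutation (Laguerre word) in $\mathfrak{S}_n^k$ is a word $\pi=\pi_1\cdots\pi_n$ of length $n$ in which exactly $k$ letters are a hole symbol $\lozenge$ and the other $n-k$ letters are distinct elements of $[n]$, with letters ordered $1<\cdots<n<\lozenge$. Let $S_\pi$ be the set of numerical letters, $\overline S_\pi=[n]\setminus S_\pi$, ${\rm inv}(A,B)=|\{(a,b)\in A\times B:a>b\}|$, ${\rm inv}_0(\pi)=|\{(j,i):1\le j<i\le n,\ \pi_j>\pi_i\}|$, ${\rm Des}(\pi)=\{i\in[n-1]:\pi_i>\pi_{i+1}\}$, ${\rm maj}_0(\pi)=\sum_{i\in{\rm Des}(\pi)}i$, ${\rm inv}(\pi)={\rm inv}_0(\pi)+{\rm inv}(S_\pi,\overline S_\pi)$ and ${\rm maj}(\pi)={\rm maj}_0(\pi)+{\rm inv}(S_\pi,\overline S_\pi)$. The matrix $M_\pi=[a_{i,j}]_{i,j=1}^n$ is the $(0,1)$-matrix with $a_{i,j}=1$ iff $\pi_i=j$ (so row $i$ is zero iff $\pi_i=\lozenge$, column $j$ is zero iff $j\notin S_\pi$). $\widetilde{{\rm inv}}(\pi)$ is the number of zero entries $(i,j)$ of $M_\pi$ that are not below a $1$ in column $j$, not to the right of a $1$ in row $i$, and not such that both row $i$ and column $j$ contain no $1$. $\widetilde{{\rm maj}}(\pi)$ is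 the number of zero entries $(\ell,j)$ of $M_\pi$ such that either (a) column $j$ contains a $1$ at position $(i,j)$ with $\ell<i$, $i\ge2$, and row $i-1$ either has its $1$ in a column to the right of $j$ or contains no $1$; or (b) column $j$ contains no $1$ and row $\ell$ contains a $1$ to the right of column $j$. -}

module Defs where

open import Data.Nat using (ℕ; zero; suc; _+_; _≡ᵇ_; _<ᵇ_)
open import Data.Fin using (Fin; toℕ)
open import Data.Bool using (Bool; true; false; if_then_else_; _∧_; _∨_; not)
open import Data.Maybe using (Maybe; just; nothing)
open import Data.List using (List; map; foldr)
open import Data.Nat.ListAction using (sum)
open import Data.List.Base using (allFin)
open import Relation.Binary.PropositionalEquality using (_≡_)

sumF : {n : ℕ} → (Fin n → ℕ) → ℕ
sumF {n} f = sum (map f (allFin n))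

countF : {n : ℕ} → (Fin n → Bool) → ℕ
countF p = sumF (λ i → if p i then 1 else 0)

countF₂ : {n : ℕ} → (Fin n → Fin n → Bool) → ℕ
countF₂ p = sumF (λ i → countF (λ j → p i j))

anyF : {n : ℕ} → (Fin n → Bool) → Bool
anyF {n} p = foldr (λ i b → p i ∨ b) false (allFin n)

-- Letters.  Position i : Fin n stands for position (toℕ i + 1) ∈ [n],
-- value a : Fin n stands for the number (toℕ a + 1) ∈ [n],
-- and nothing stands for the hole symbol ◊.  Order 1 < ⋯ < n < ◊.

_<F_ : {n : ℕ} → Fin n → Fin n → Bool
a <F b = toℕ a <ᵇ toℕ b

_≡F_ : {n : ℕ} → Fin n → Fin n → Bool
a ≡F b = toℕ a ≡ᵇ toℕ b

_>L_ : {n : ℕ} → Maybe (Fin n) → Maybe (Fin n) → Bool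
just a  >L just b  = b <F a
just a  >L nothing = false
nothing >L just b  = true
nothing >L nothing = false

isHole : {n : ℕ} → Maybe (Fin n) → Bool
isHole nothing  = true
isHole (just _) = false

isLetter : {n : ℕ} → Maybe (Fin n) → Fin n → Bool
isLetter (just a) j = a ≡F j
isLetter nothing  j = false

Word : ℕ → Set
Word n = Fin n → Maybe (Fin n)

record PartialPerm (n k : ℕ) : Set where
  field
    word      : Word n
    injective : ∀ (i j : Fin n) (a : Fin n) →
                word i ≡ just a → word j ≡ just a → i ≡ j
    holes     : countF (λ i → isHole (word i)) ≡ k
open PartialPerm public

module _ {n : ℕ} (π : Word n) where

  inS : Fin n → Bool
  inS j = anyF (λ i → isLetter (π i) j)

  invSSbar : ℕ
  invSSbar = countF₂ (λ a b → inS a ∧ not (inS b) ∧ (b <F a))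

  inv₀ : ℕ
  inv₀ = countF₂ (λ j i → (j <F i) ∧ (π j >L π i))

  -- maj₀(π) = Σ_{i ∈ Des π} i  (1-based positions);
  -- a descent at (1-based) position p+1 is a pair of positions p, q with q = p+1
  -- (0-based) and π_p > π_q.
  maj₀ : ℕ
  maj₀ = sumF (λ p → sumF (λ q →
           if (toℕ q ≡ᵇ suc (toℕ p)) ∧ (π p >L π q) then suc (toℕ p) else 0))

  inv : ℕ
  inv = inv₀ + invSSbar

  maj : ℕ
  maj = maj₀ + invSSbar

  -- entries of the matrix M_π : a_{i,j} = 1 iff π_i = j
  entry1 : Fin n → Fin n → Bool
  entry1 i j = isLetter (π i) j

  rowHasOne : Fin n → Bool
  rowHasOne i = not (isHole (π i))

  colHasOne : Fin n → Bool
  colHasOne j = inS j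

  invTilde : ℕ
  invTilde = countF₂ (λ i j →
      not (entry1 i j)
    ∧ not (anyF (λ i' → (i' <F i) ∧ entry1 i' j))
    ∧ not (anyF (λ j' → (j' <F j) ∧ entry1 i j'))
    ∧ not (not (rowHasOne i) ∧ not (colHasOne j)))

  majTilde : ℕ
  majTilde = countF₂ (λ ℓ j →
      not (entry1 ℓ j)
    ∧ ( anyF (λ i → entry1 i j ∧ (ℓ <F i) ∧
          anyF (λ p → (toℕ i ≡ᵇ suc (toℕ p)) ∧ (π p >L just j)))
      ∨ (not (colHasOne j) ∧ anyF (λ j' → (j <F j') ∧ entry1 ℓ j'))))

-- Classify a zero entry (i , j) of M_π by its column.  If column j is empty,
-- the entry is counted by both ĩnv and m̃aj exactly when row i has its 1 to
-- the right of column j, i.e. j ∉ S_π lies below π_i ∈ S_π; grouped by the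
-- letter π_i these entries are the pairs counted by inv(S_π , S̄_π).  If the
-- 1 of column j sits in row i', the entry is counted by ĩnv exactly when
-- i < i' and π_i > π_i' = j, so over all j these are the inversions of π; and
-- it is counted by m̃aj exactly when i < i' and i' − 1 is a descent of π, so
-- a descent at position d is counted once for each of the d rows above row
-- d + 1, which is its contribution to maj₀.

module Submission where

open import Defs
open import Data.Bool using (Bool; true; false; if_then_else_; _∧_; _∨_; not; T)
open import Data.Bool.Properties using (∨-zeroʳ; ∨-identityʳ; ∧-zeroʳ; ∧-identityʳ; ¬-not)
open import Data.Fin using (Fin; toℕ; zero; suc; punchIn; inject₁; _≟_)
open import Data.Fin.Properties using (toℕ-injective; toℕ-inject₁; punchInᵢ≢i)
open import Data.List using ([]; _∷_; foldr; tabulate; allFin)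
open import Data.List.Membership.Propositional using (_∈_)
open import Data.List.Membership.Propositional.Properties using (∈-allFin)
open import Data.List.Properties using (map-tabulate; map-cong)
open import Data.List.Relation.Unary.Any using (here; there)
open import Data.Maybe using (Maybe; just; nothing)
open import Data.Nat using (ℕ; zero; suc; _+_; _≡ᵇ_; _<ᵇ_)
open import Data.Nat.ListAction using (sum)
open import Data.Nat.Properties using (+-identityʳ; +-comm; +-0-commutativeMonoid; ≡ᵇ⇒≡)
open import Data.Product using (∃; _×_; _,_)
open import Data.Unit using (tt)
open import Function using (_∘_)
open import Relation.Binary.PropositionalEquality
open import Relation.Nullary using (yes; no; contradiction)
import Algebra.Properties.CommutativeMonoid.Sum +-0-commutativeMonoid as ∑

⟦_⟧ : Bool → ℕ
⟦ b ⟧ = if b then 1 else 0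

≡ᵇ-refl : ∀ m → (m ≡ᵇ m) ≡ true
≡ᵇ-refl zero    = refl
≡ᵇ-refl (suc m) = ≡ᵇ-refl m

≡ᵇ-true⇒≡ : ∀ {m k} → (m ≡ᵇ k) ≡ true → m ≡ k
≡ᵇ-true⇒≡ {m} {k} m≡ᵇk = ≡ᵇ⇒≡ m k (subst T (sym m≡ᵇk) tt)

<ᵇ-irrefl : ∀ m → (m <ᵇ m) ≡ false
<ᵇ-irrefl zero    = refl
<ᵇ-irrefl (suc m) = <ᵇ-irrefl m

not-≡ᵇ∧not-<ᵇ : ∀ m n → (not (m ≡ᵇ n) ∧ not (m <ᵇ n)) ≡ (n <ᵇ m)
not-≡ᵇ∧not-<ᵇ zero    zero    = refl
not-≡ᵇ∧not-<ᵇ zero    (suc n) = refl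
not-≡ᵇ∧not-<ᵇ (suc m) zero    = refl
not-≡ᵇ∧not-<ᵇ (suc m) (suc n) = not-≡ᵇ∧not-<ᵇ m n

sum-tabulate : ∀ {n} (f : Fin n → ℕ) → sum (tabulate f) ≡ ∑.sum f
sum-tabulate {zero}  f = refl
sum-tabulate {suc n} f = cong (f zero +_) (sum-tabulate (f ∘ suc))

sumF≡∑ : ∀ {n} (f : Fin n → ℕ) → sumF f ≡ ∑.sum f
sumF≡∑ {n} f = trans (cong sum (map-tabulate (λ i → i) f)) (sum-tabulate f)

sumF-cong : ∀ {n} {f g : Fin n → ℕ} → (∀ i → f i ≡ g i) → sumF f ≡ sumF g
sumF-cong {n} f≗g = cong sum (map-cong f≗g (allFin n))

sumF-distrib-+ : ∀ {n} (f g : Fin n → ℕ) → sumF (λ i → f i + g i) ≡ sumF f + sumF g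
sumF-distrib-+ f g = begin
  sumF (λ i → f i + g i)  ≡⟨ sumF≡∑ (λ i → f i + g i) ⟩
  ∑.sum (λ i → f i + g i) ≡⟨ ∑.∑-distrib-+ f g ⟩
  ∑.sum f + ∑.sum g       ≡⟨ sym (cong₂ _+_ (sumF≡∑ f) (sumF≡∑ g)) ⟩
  sumF f + sumF g         ∎
  where open ≡-Reasoning

sumF²≡∑² : ∀ {m n} (f : Fin m → Fin n → ℕ) →
           sumF (λ i → sumF (f i)) ≡ ∑.sum (λ i → ∑.sum (f i))
sumF²≡∑² f = trans (sumF≡∑ (λ i → sumF (f i))) (∑.sum-cong-≗ (λ i → sumF≡∑ (f i)))

sumF-comm : ∀ {m n} (f : Fin m → Fin n → ℕ) →
            sumF (λ i → sumF (λ j → f i j)) ≡ sumF (λ j → sumF (λ i → f i j))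
sumF-comm f = trans (sumF²≡∑² f) (trans (∑.∑-comm f) (sym (sumF²≡∑² (λ j i → f i j))))

sumF²-distrib-+ : ∀ {m n} (f g : Fin m → Fin n → ℕ) →
                  sumF (λ i → sumF (λ j → f i j + g i j))
                  ≡ sumF (λ i → sumF (f i)) + sumF (λ i → sumF (g i))
sumF²-distrib-+ f g = trans (sumF-cong (λ i → sumF-distrib-+ (f i) (g i)))
                            (sumF-distrib-+ (λ i → sumF (f i)) (λ i → sumF (g i)))

∑-zero : ∀ {n} (f : Fin n → ℕ) → (∀ i → f i ≡ 0) → ∑.sum f ≡ 0
∑-zero {n} f f≗0 = trans (∑.sum-cong-≗ f≗0) (∑.sum-replicate-zero n)

sumF-zero : ∀ {n} (f : Fin n → ℕ) → (∀ i → f i ≡ 0) → sumF f ≡ 0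
sumF-zero f f≗0 = trans (sumF≡∑ f) (∑-zero f f≗0)

sumF-δ : ∀ {n} (f : Fin n → ℕ) (i₀ : Fin n) → (∀ i → i ≢ i₀ → f i ≡ 0) → sumF f ≡ f i₀
sumF-δ {suc n} f i₀ f≗0 = begin
  sumF f                                 ≡⟨ sumF≡∑ f ⟩
  ∑.sum f                                ≡⟨ ∑.sum-remove f ⟩
  f i₀ + ∑.sum (λ k → f (punchIn i₀ k))  ≡⟨ cong (f i₀ +_) (∑-zero _ (λ k → f≗0 _ (punchInᵢ≢i i₀ k))) ⟩
  f i₀ + 0                               ≡⟨ +-identityʳ (f i₀) ⟩
  f i₀                                   ∎
  where open ≡-Reasoning

countF-< : ∀ {n} (i : Fin n) → countF (λ l → l <F i) ≡ toℕ i
countF-< i = trans (sumF≡∑ (λ l → ⟦ l <F i ⟧)) (go i)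
  where
  go : ∀ {n} (i : Fin n) → ∑.sum (λ l → ⟦ l <F i ⟧) ≡ toℕ i
  go {suc n} zero    = ∑-zero {n} _ (λ _ → refl)
  go {suc n} (suc i) = cong suc (go i)

countF-<-∧ : ∀ {n} (i : Fin n) (b : Bool) →
             countF (λ ℓ → (ℓ <F i) ∧ b) ≡ (if b then toℕ i else 0)
countF-<-∧ i true  = trans (sumF-cong (λ ℓ → cong ⟦_⟧ (∧-identityʳ (ℓ <F i)))) (countF-< i)
countF-<-∧ i false = sumF-zero (λ ℓ → ⟦ (ℓ <F i) ∧ false ⟧) (λ ℓ → cong ⟦_⟧ (∧-zeroʳ (ℓ <F i)))

module _ {A : Set} (p : A → Bool) where

  any-false : ∀ xs → (∀ x → p x ≡ false) → foldr (λ x b → p x ∨ b) false xs ≡ false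
  any-false []       _    = refl
  any-false (x ∷ xs) p≗ff rewrite p≗ff x = any-false xs p≗ff

  any-true : ∀ {x xs} → x ∈ xs → p x ≡ true → foldr (λ x b → p x ∨ b) false xs ≡ true
  any-true (here refl) px rewrite px = refl
  any-true {xs = y ∷ _} (there x∈xs) px rewrite any-true x∈xs px = ∨-zeroʳ (p y)

  any-witness : ∀ xs → foldr (λ x b → p x ∨ b) false xs ≡ true → ∃ λ x → p x ≡ true
  any-witness (x ∷ xs) h with p x in px
  ... | true  = x , px
  ... | false = any-witness xs h

anyF-false : ∀ {n} (p : Fin n → Bool) → (∀ i → p i ≡ false) → anyF p ≡ false
anyF-false {n} p = any-false p (allFin n)

anyF-true : ∀ {n} (p : Fin n → Bool) (i : Fin n) → p i ≡ true → anyF p ≡ true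
anyF-true p i = any-true p (∈-allFin i)

anyF-witness : ∀ {n} (p : Fin n → Bool) → anyF p ≡ true → ∃ λ i → p i ≡ true
anyF-witness {n} p = any-witness p (allFin n)

anyF-δ : ∀ {n} (p : Fin n → Bool) (i₀ : Fin n) → (∀ i → i ≢ i₀ → p i ≡ false) → anyF p ≡ p i₀
anyF-δ p i₀ p≗ff with p i₀ in pi₀
... | true  = anyF-true p i₀ pi₀
... | false = anyF-false p off
  where
  off : ∀ i → p i ≡ false
  off i with i ≟ i₀
  ... | yes refl = pi₀
  ... | no  i≢i₀ = p≗ff i i≢i₀

≢inject₁⇒≡ᵇ-false : ∀ {n} (q : Fin n) (p : Fin (suc n)) →
                     p ≢ inject₁ q → (toℕ q ≡ᵇ toℕ p) ≡ false
≢inject₁⇒≡ᵇ-false q p p≢q = ¬-not λ q≡ᵇp →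
  p≢q (toℕ-injective (trans (sym (≡ᵇ-true⇒≡ q≡ᵇp)) (sym (toℕ-inject₁ q))))

sumF-predecessor : ∀ {n} (q : Fin n) (Q : Fin n → Bool) →
  sumF (λ p → if (toℕ q ≡ᵇ suc (toℕ p)) ∧ Q p then suc (toℕ p) else 0)
  ≡ (if anyF (λ p → (toℕ q ≡ᵇ suc (toℕ p)) ∧ Q p) then toℕ q else 0)
sumF-predecessor {suc n} zero Q
  rewrite anyF-false (λ p → (0 ≡ᵇ suc (toℕ p)) ∧ Q p) (λ _ → refl) =
  sumF-zero {suc n} (λ _ → 0) (λ _ → refl)
sumF-predecessor {suc n} (suc q) Q
  rewrite sumF-δ (λ p → if (suc (toℕ q) ≡ᵇ suc (toℕ p)) ∧ Q p then suc (toℕ p) else 0) (inject₁ q)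
                 (λ p p≢q → cong (λ b → if b ∧ Q p then suc (toℕ p) else 0) (≢inject₁⇒≡ᵇ-false q p p≢q))
        | anyF-δ (λ p → (suc (toℕ q) ≡ᵇ suc (toℕ p)) ∧ Q p) (inject₁ q)
                 (λ p p≢q → cong (_∧ Q p) (≢inject₁⇒≡ᵇ-false q p p≢q))
        | toℕ-inject₁ q = refl

module _ {n : ℕ} where

  ≡F-refl : (a : Fin n) → (a ≡F a) ≡ true
  ≡F-refl a = ≡ᵇ-refl (toℕ a)

  ≡F⇒≡ : {a b : Fin n} → (a ≡F b) ≡ true → a ≡ b
  ≡F⇒≡ a≡Fb = toℕ-injective (≡ᵇ-true⇒≡ a≡Fb)

  ≢⇒≡F-false : {a b : Fin n} → a ≢ b → (a ≡F b) ≡ false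
  ≢⇒≡F-false a≢b = ¬-not (a≢b ∘ ≡F⇒≡)

  <F-irrefl : (a : Fin n) → (a <F a) ≡ false
  <F-irrefl a = <ᵇ-irrefl (toℕ a)

  ≢⇒not-<F : {a b : Fin n} → a ≢ b → not (a <F b) ≡ (b <F a)
  ≢⇒not-<F {a} {b} a≢b =
    subst (λ e → (not e ∧ not (a <F b)) ≡ (b <F a)) (≢⇒≡F-false a≢b)
          (not-≡ᵇ∧not-<ᵇ (toℕ a) (toℕ b))

  onLetter : Maybe (Fin n) → (Fin n → Bool) → Bool
  onLetter (just a) P = P a
  onLetter nothing  P = false

  onLetter-∧ : (x : Maybe (Fin n)) (b : Bool) (P : Fin n → Bool) →
               onLetter x (λ a → b ∧ P a) ≡ (b ∧ onLetter x P)
  onLetter-∧ (just a) b P = refl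
  onLetter-∧ nothing  b P = sym (∧-zeroʳ b)

  >L-nothing : (x : Maybe (Fin n)) → (x >L nothing) ≡ false
  >L-nothing (just a) = refl
  >L-nothing nothing  = refl

  onLetter->L : (y x : Maybe (Fin n)) → onLetter x (λ a → y >L just a) ≡ (y >L x)
  onLetter->L y (just a) = refl
  onLetter->L y nothing  = sym (>L-nothing y)

  isLetter⇒≡just : (x : Maybe (Fin n)) (j : Fin n) → isLetter x j ≡ true → x ≡ just j
  isLetter⇒≡just (just a) j a≡Fj = cong just (≡F⇒≡ a≡Fj)

  module _ (q : Fin n → Bool) (i₀ : Fin n) (qi₀ : q i₀ ≡ true)
           (q≗false : ∀ i → i ≢ i₀ → q i ≡ false) where

    sumF-unique : (P : Fin n → Bool) → sumF (λ i → ⟦ q i ∧ P i ⟧) ≡ ⟦ P i₀ ⟧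
    sumF-unique P =
      trans (sumF-δ (λ i → ⟦ q i ∧ P i ⟧) i₀ (λ i i≢i₀ → cong (λ b → ⟦ b ∧ P i ⟧) (q≗false i i≢i₀)))
            (cong (λ b → ⟦ b ∧ P i₀ ⟧) qi₀)

    anyF-uniqueˡ : (P : Fin n → Bool) → anyF (λ i → q i ∧ P i) ≡ P i₀
    anyF-uniqueˡ P =
      trans (anyF-δ (λ i → q i ∧ P i) i₀ (λ i i≢i₀ → cong (_∧ P i) (q≗false i i≢i₀)))
            (cong (_∧ P i₀) qi₀)

    anyF-uniqueʳ : (P : Fin n → Bool) → anyF (λ i → P i ∧ q i) ≡ P i₀
    anyF-uniqueʳ P =
      trans (anyF-δ (λ i → P i ∧ q i) i₀ (λ i i≢i₀ → trans (cong (P i ∧_) (q≗false i i≢i₀)) (∧-zeroʳ (P i))))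
            (trans (cong (P i₀ ∧_) qi₀) (∧-identityʳ (P i₀)))

  isLetter-unique : (a : Fin n) → ∀ j → j ≢ a → isLetter (just a) j ≡ false
  isLetter-unique a j j≢a = ≢⇒≡F-false (j≢a ∘ sym)

  sumF-row : (x : Maybe (Fin n)) (P : Fin n → Bool) →
             sumF (λ j → ⟦ isLetter x j ∧ P j ⟧) ≡ ⟦ onLetter x P ⟧
  sumF-row (just a) = sumF-unique (isLetter (just a)) a (≡F-refl a) (isLetter-unique a)
  sumF-row nothing  P = sumF-zero (λ j → ⟦ false ∧ P j ⟧) (λ _ → refl)

  anyF-row : (x : Maybe (Fin n)) (P : Fin n → Bool) →
             anyF (λ j → P j ∧ isLetter x j) ≡ onLetter x P
  anyF-row (just a) = anyF-uniqueʳ (isLetter (just a)) a (≡F-refl a) (isLetter-unique a)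
  anyF-row nothing  P = anyF-false (λ j → P j ∧ false) (λ j → ∧-zeroʳ (P j))

module InjectiveWord {n : ℕ} (π : Word n)
  (π-injective : ∀ (i j : Fin n) (a : Fin n) → π i ≡ just a → π j ≡ just a → i ≡ j) where

  data Column (j : Fin n) : Set where
    occupied : (i₀ : Fin n) → π i₀ ≡ just j → Column j
    empty    : (∀ i → entry1 π i j ≡ false) → Column j

  column : ∀ j → Column j
  column j with inS π j in j∈S
  ... | true  = let (i₀ , π-i₀≈j) = anyF-witness (λ i → entry1 π i j) j∈S
                in occupied i₀ (isLetter⇒≡just (π i₀) j π-i₀≈j)
  ... | false = empty λ i → ¬-not λ π-i≈j →
    contradiction (trans (sym (anyF-true (λ i → entry1 π i j) i π-i≈j)) j∈S) λ ()

  invTildeCell : Fin n → Fin n → Bool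
  invTildeCell i j =
      not (entry1 π i j)
    ∧ not (anyF (λ i' → (i' <F i) ∧ entry1 π i' j))
    ∧ not (anyF (λ j' → (j' <F j) ∧ entry1 π i j'))
    ∧ not (not (rowHasOne π i) ∧ not (colHasOne π j))

  emptyColumnLeftOfOne : Fin n → Fin n → Bool
  emptyColumnLeftOfOne i j = not (inS π j) ∧ onLetter (π i) (j <F_)

  aboveInversion : Fin n → Fin n → Fin n → Bool
  aboveInversion i j i' = entry1 π i' j ∧ ((i <F i') ∧ (π i >L just j))

  precededByLarger : Fin n → Fin n → Bool
  precededByLarger i j = anyF (λ p → (toℕ i ≡ᵇ suc (toℕ p)) ∧ (π p >L just j))

  majTildeCell : Fin n → Fin n → Bool
  majTildeCell ℓ j =
      not (entry1 π ℓ j)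
    ∧ ( anyF (λ i → entry1 π i j ∧ (ℓ <F i) ∧ precededByLarger i j)
      ∨ (not (colHasOne π j) ∧ anyF (λ j' → (j <F j') ∧ entry1 π ℓ j')))

  aboveDescentBottom : Fin n → Fin n → Fin n → Bool
  aboveDescentBottom ℓ j i = entry1 π i j ∧ ((ℓ <F i) ∧ precededByLarger i j)

  module Occupied {i₀ j : Fin n} (π-i₀ : π i₀ ≡ just j) where

    entry-i₀ : entry1 π i₀ j ≡ true
    entry-i₀ rewrite π-i₀ = ≡F-refl j

    entry-elsewhere : ∀ i → i ≢ i₀ → entry1 π i j ≡ false
    entry-elsewhere i i≢i₀ = ¬-not λ π-i≈j →
      i≢i₀ (π-injective i i₀ j (isLetter⇒≡just (π i) j π-i≈j) π-i₀)

    j∈S : inS π j ≡ true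
    j∈S = anyF-true (λ i → entry1 π i j) i₀ entry-i₀

    sumF-column : (P : Fin n → Bool) → sumF (λ i → ⟦ entry1 π i j ∧ P i ⟧) ≡ ⟦ P i₀ ⟧
    sumF-column = sumF-unique (λ i → entry1 π i j) i₀ entry-i₀ entry-elsewhere

    anyF-columnˡ : (P : Fin n → Bool) → anyF (λ i → entry1 π i j ∧ P i) ≡ P i₀
    anyF-columnˡ = anyF-uniqueˡ (λ i → entry1 π i j) i₀ entry-i₀ entry-elsewhere

    anyF-columnʳ : (P : Fin n → Bool) → anyF (λ i → P i ∧ entry1 π i j) ≡ P i₀
    anyF-columnʳ = anyF-uniqueʳ (λ i → entry1 π i j) i₀ entry-i₀ entry-elsewhere

    emptyColumnLeftOfOne-occupied : ∀ i → emptyColumnLeftOfOne i j ≡ false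
    emptyColumnLeftOfOne-occupied i = cong (λ b → not b ∧ onLetter (π i) (j <F_)) j∈S

    invTildeCell-occupied : ∀ i → ⟦ invTildeCell i j ⟧ ≡ ⟦ (i <F i₀) ∧ (π i >L just j) ⟧
    invTildeCell-occupied i
      rewrite anyF-columnʳ (_<F i) | j∈S | anyF-row (π i) (_<F j) with i ≟ i₀
    ... | yes refl rewrite entry-i₀ | <F-irrefl i = refl
    ... | no i≢i₀ rewrite entry-elsewhere i i≢i₀ | ≢⇒not-<F (i≢i₀ ∘ sym) with π i in π-i
    ...   | nothing = refl
    ...   | just a rewrite ≢⇒not-<F {a = a} {b = j} (λ { refl → i≢i₀ (π-injective i i₀ a π-i π-i₀) })
                         | ∧-identityʳ (j <F a) = refl

    invTildeCell-split : ∀ i → ⟦ invTildeCell i j ⟧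
                               ≡ ⟦ emptyColumnLeftOfOne i j ⟧ + countF (aboveInversion i j)
    invTildeCell-split i = trans (invTildeCell-occupied i) (sym (cong₂ _+_
      (cong ⟦_⟧ (emptyColumnLeftOfOne-occupied i))
      (sumF-column (λ i' → (i <F i') ∧ (π i >L just j)))))

    majTildeCell-occupied : ∀ ℓ → ⟦ majTildeCell ℓ j ⟧ ≡ ⟦ (ℓ <F i₀) ∧ precededByLarger i₀ j ⟧
    majTildeCell-occupied ℓ
      rewrite anyF-columnˡ (λ i → (ℓ <F i) ∧ precededByLarger i j) | j∈S with ℓ ≟ i₀
    ... | yes refl rewrite entry-i₀ | <F-irrefl ℓ = refl
    ... | no ℓ≢i₀ rewrite entry-elsewhere ℓ ℓ≢i₀ = cong ⟦_⟧ (∨-identityʳ _)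

    majTildeCell-split : ∀ ℓ → ⟦ majTildeCell ℓ j ⟧
                               ≡ ⟦ emptyColumnLeftOfOne ℓ j ⟧ + countF (aboveDescentBottom ℓ j)
    majTildeCell-split ℓ = trans (majTildeCell-occupied ℓ) (sym (cong₂ _+_
      (cong ⟦_⟧ (emptyColumnLeftOfOne-occupied ℓ))
      (sumF-column (λ i → (ℓ <F i) ∧ precededByLarger i j))))

  module Empty {j : Fin n} (no-entry : ∀ i → entry1 π i j ≡ false) where

    j∉S : inS π j ≡ false
    j∉S = anyF-false (λ i → entry1 π i j) no-entry

    sumF-column : (P : Fin n → Bool) → sumF (λ i → ⟦ entry1 π i j ∧ P i ⟧) ≡ 0
    sumF-column P = sumF-zero (λ i → ⟦ entry1 π i j ∧ P i ⟧) (λ i → cong (λ b → ⟦ b ∧ P i ⟧) (no-entry i))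

    anyF-columnˡ : (P : Fin n → Bool) → anyF (λ i → entry1 π i j ∧ P i) ≡ false
    anyF-columnˡ P = anyF-false (λ i → entry1 π i j ∧ P i) (λ i → cong (_∧ P i) (no-entry i))

    anyF-columnʳ : (P : Fin n → Bool) → anyF (λ i → P i ∧ entry1 π i j) ≡ false
    anyF-columnʳ P =
      anyF-false (λ i → P i ∧ entry1 π i j) (λ i → trans (cong (P i ∧_) (no-entry i)) (∧-zeroʳ (P i)))

    letter≢j : ∀ {i a} → π i ≡ just a → a ≢ j
    letter≢j {i} π-i refl =
      contradiction (trans (sym (≡F-refl j)) (subst (λ x → isLetter x j ≡ false) π-i (no-entry i))) λ ()

    emptyColumnLeftOfOne-empty : ∀ i → emptyColumnLeftOfOne i j ≡ onLetter (π i) (j <F_)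
    emptyColumnLeftOfOne-empty i = cong (λ b → not b ∧ onLetter (π i) (j <F_)) j∉S

    invTildeCell-empty : ∀ i → ⟦ invTildeCell i j ⟧ ≡ ⟦ onLetter (π i) (j <F_) ⟧
    invTildeCell-empty i
      rewrite no-entry i | anyF-columnʳ (_<F i) | j∉S | anyF-row (π i) (_<F j) with π i in π-i
    ... | nothing = refl
    ... | just a rewrite ∧-identityʳ (not (a <F j)) = cong ⟦_⟧ (≢⇒not-<F (letter≢j π-i))

    invTildeCell-split : ∀ i → ⟦ invTildeCell i j ⟧
                               ≡ ⟦ emptyColumnLeftOfOne i j ⟧ + countF (aboveInversion i j)
    invTildeCell-split i = trans (invTildeCell-empty i) (sym (trans (cong₂ _+_
      (cong ⟦_⟧ (emptyColumnLeftOfOne-empty i))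
      (sumF-column (λ i' → (i <F i') ∧ (π i >L just j)))) (+-identityʳ _)))

    majTildeCell-empty : ∀ ℓ → ⟦ majTildeCell ℓ j ⟧ ≡ ⟦ onLetter (π ℓ) (j <F_) ⟧
    majTildeCell-empty ℓ
      rewrite no-entry ℓ | anyF-columnˡ (λ i → (ℓ <F i) ∧ precededByLarger i j)
            | j∉S | anyF-row (π ℓ) (j <F_) = refl

    majTildeCell-split : ∀ ℓ → ⟦ majTildeCell ℓ j ⟧
                               ≡ ⟦ emptyColumnLeftOfOne ℓ j ⟧ + countF (aboveDescentBottom ℓ j)
    majTildeCell-split ℓ = trans (majTildeCell-empty ℓ) (sym (trans (cong₂ _+_
      (cong ⟦_⟧ (emptyColumnLeftOfOne-empty ℓ))
      (sumF-column (λ i → (ℓ <F i) ∧ precededByLarger i j))) (+-identityʳ _)))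

  sumF-column : ∀ a (Q : Bool) → sumF (λ i → ⟦ entry1 π i a ∧ Q ⟧) ≡ ⟦ inS π a ∧ Q ⟧
  sumF-column a Q with column a
  ... | occupied i₀ π-i₀ rewrite Occupied.j∈S π-i₀ = Occupied.sumF-column π-i₀ (λ _ → Q)
  ... | empty no-entry   rewrite Empty.j∉S no-entry = Empty.sumF-column no-entry (λ _ → Q)

  count-emptyColumnLeftOfOne≡invSSbar : countF₂ emptyColumnLeftOfOne ≡ invSSbar π
  count-emptyColumnLeftOfOne≡invSSbar = begin
      sumF (λ i → sumF (λ j → ⟦ emptyColumnLeftOfOne i j ⟧))
    ≡⟨ sumF-cong (λ i → sumF-cong (λ j → cong ⟦_⟧ (sym (onLetter-∧ (π i) (not (inS π j)) (j <F_))))) ⟩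
      sumF (λ i → sumF (λ j → ⟦ onLetter (π i) (λ a → not (inS π j) ∧ (j <F a)) ⟧))
    ≡⟨ sumF-cong (λ i → sumF-cong (λ j → sym (sumF-row (π i) (λ a → not (inS π j) ∧ (j <F a))))) ⟩
      sumF (λ i → sumF (λ j → sumF (λ a → atLetter i j a)))
    ≡⟨ sumF-cong (λ i → sumF-comm (atLetter i)) ⟩
      sumF (λ i → sumF (λ a → sumF (λ j → atLetter i j a)))
    ≡⟨ sumF-comm (λ i a → sumF (λ j → atLetter i j a)) ⟩
      sumF (λ a → sumF (λ i → sumF (λ j → atLetter i j a)))
    ≡⟨ sumF-cong (λ a → sumF-comm (λ i j → atLetter i j a)) ⟩
      sumF (λ a → sumF (λ j → sumF (λ i → atLetter i j a)))
    ≡⟨ sumF-cong (λ a → sumF-cong (λ j → sumF-column a (not (inS π j) ∧ (j <F a)))) ⟩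
      invSSbar π ∎
    where
    open ≡-Reasoning
    atLetter : Fin n → Fin n → Fin n → ℕ
    atLetter i j a = ⟦ isLetter (π i) a ∧ (not (inS π j) ∧ (j <F a)) ⟧

  invTildeCell-split : ∀ i j → ⟦ invTildeCell i j ⟧
                               ≡ ⟦ emptyColumnLeftOfOne i j ⟧ + countF (aboveInversion i j)
  invTildeCell-split i j with column j
  ... | occupied i₀ π-i₀ = Occupied.invTildeCell-split π-i₀ i
  ... | empty no-entry   = Empty.invTildeCell-split no-entry i

  count-aboveInversion≡inv₀ : sumF (λ i → sumF (λ j → countF (aboveInversion i j))) ≡ inv₀ π
  count-aboveInversion≡inv₀ = sumF-cong (λ i →
    trans (sumF-comm (λ j i' → ⟦ aboveInversion i j i' ⟧)) (sumF-cong (λ i' → row i i')))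
    where
    row : ∀ i i' → countF (λ j → aboveInversion i j i') ≡ ⟦ (i <F i') ∧ (π i >L π i') ⟧
    row i i' = trans (sumF-row (π i') (λ j → (i <F i') ∧ (π i >L just j))) (cong ⟦_⟧ (trans
      (onLetter-∧ (π i') (i <F i') (λ j → π i >L just j))
      (cong ((i <F i') ∧_) (onLetter->L (π i) (π i')))))

  inv≡invTilde : inv π ≡ invTilde π
  inv≡invTilde = sym (begin
    invTilde π
      ≡⟨ sumF-cong (λ i → sumF-cong (invTildeCell-split i)) ⟩
    sumF (λ i → sumF (λ j → ⟦ emptyColumnLeftOfOne i j ⟧ + countF (aboveInversion i j)))
      ≡⟨ sumF²-distrib-+ (λ i j → ⟦ emptyColumnLeftOfOne i j ⟧) (λ i j → countF (aboveInversion i j)) ⟩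
    countF₂ emptyColumnLeftOfOne + sumF (λ i → sumF (λ j → countF (aboveInversion i j)))
      ≡⟨ cong₂ _+_ count-emptyColumnLeftOfOne≡invSSbar count-aboveInversion≡inv₀ ⟩
    invSSbar π + inv₀ π
      ≡⟨ +-comm (invSSbar π) (inv₀ π) ⟩
    inv π ∎)
    where open ≡-Reasoning

  majTildeCell-split : ∀ ℓ j → ⟦ majTildeCell ℓ j ⟧
                               ≡ ⟦ emptyColumnLeftOfOne ℓ j ⟧ + countF (aboveDescentBottom ℓ j)
  majTildeCell-split ℓ j with column j
  ... | occupied i₀ π-i₀ = Occupied.majTildeCell-split π-i₀ ℓ
  ... | empty no-entry   = Empty.majTildeCell-split no-entry ℓ

  -- Positions are 0-based: row i is the bottom of a descent at position toℕ i.
  descentWeight : Fin n → ℕ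
  descentWeight i = if onLetter (π i) (precededByLarger i) then toℕ i else 0

  sum-descentWeight≡maj₀ : sumF descentWeight ≡ maj₀ π
  sum-descentWeight≡maj₀ = sym (trans (sumF-comm (λ p q → weight p q)) (sumF-cong descentInto))
    where
    weight : Fin n → Fin n → ℕ
    weight p q = if (toℕ q ≡ᵇ suc (toℕ p)) ∧ (π p >L π q) then suc (toℕ p) else 0
    descentInto : ∀ q → sumF (λ p → weight p q) ≡ descentWeight q
    descentInto q with π q
    ... | just a  = sumF-predecessor q (λ p → π p >L just a)
    ... | nothing =
      sumF-zero (λ p → if (toℕ q ≡ᵇ suc (toℕ p)) ∧ (π p >L nothing) then suc (toℕ p) else 0) λ p →
        cong (λ b → if b then suc (toℕ p) else 0)
             (trans (cong ((toℕ q ≡ᵇ suc (toℕ p)) ∧_) (>L-nothing (π p))) (∧-zeroʳ _))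

  count-aboveDescentBottom≡maj₀ : sumF (λ ℓ → sumF (λ j → countF (aboveDescentBottom ℓ j))) ≡ maj₀ π
  count-aboveDescentBottom≡maj₀ = begin
    sumF (λ ℓ → sumF (λ j → countF (aboveDescentBottom ℓ j)))
      ≡⟨ sumF-cong (λ ℓ → trans (sumF-comm (λ j i → ⟦ aboveDescentBottom ℓ j i ⟧)) (sumF-cong (row ℓ))) ⟩
    sumF (λ ℓ → countF (λ i → (ℓ <F i) ∧ onLetter (π i) (precededByLarger i)))
      ≡⟨ sumF-comm (λ ℓ i → ⟦ (ℓ <F i) ∧ onLetter (π i) (precededByLarger i) ⟧) ⟩
    sumF (λ i → countF (λ ℓ → (ℓ <F i) ∧ onLetter (π i) (precededByLarger i)))
      ≡⟨ sumF-cong (λ i → countF-<-∧ i (onLetter (π i) (precededByLarger i))) ⟩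
    sumF descentWeight
      ≡⟨ sum-descentWeight≡maj₀ ⟩
    maj₀ π ∎
    where
    open ≡-Reasoning
    row : ∀ ℓ i → countF (λ j → aboveDescentBottom ℓ j i)
                  ≡ ⟦ (ℓ <F i) ∧ onLetter (π i) (precededByLarger i) ⟧
    row ℓ i = trans (sumF-row (π i) (λ j → (ℓ <F i) ∧ precededByLarger i j))
                    (cong ⟦_⟧ (onLetter-∧ (π i) (ℓ <F i) (precededByLarger i)))

  maj≡majTilde : maj π ≡ majTilde π
  maj≡majTilde = sym (begin
    majTilde π
      ≡⟨ sumF-cong (λ ℓ → sumF-cong (majTildeCell-split ℓ)) ⟩
    sumF (λ ℓ → sumF (λ j → ⟦ emptyColumnLeftOfOne ℓ j ⟧ + countF (aboveDescentBottom ℓ j)))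
      ≡⟨ sumF²-distrib-+ (λ ℓ j → ⟦ emptyColumnLeftOfOne ℓ j ⟧) (λ ℓ j → countF (aboveDescentBottom ℓ j)) ⟩
    countF₂ emptyColumnLeftOfOne + sumF (λ ℓ → sumF (λ j → countF (aboveDescentBottom ℓ j)))
      ≡⟨ cong₂ _+_ count-emptyColumnLeftOfOne≡invSSbar count-aboveDescentBottom≡maj₀ ⟩
    invSSbar π + maj₀ π
      ≡⟨ +-comm (invSSbar π) (maj₀ π) ⟩
    maj π ∎)
    where open ≡-Reasoning

proposition3p1 : (n k : ℕ) (π : PartialPerm n k) →
    (inv (word π) ≡ invTilde (word π)) × (maj (word π) ≡ majTilde (word π))
proposition3p1 n k π = inv≡invTilde , maj≡majTilde
  where open InjectiveWord (word π) (injective π)
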